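{- Let $M_G=(H,\sigma,\alpha)$ be a combinatorial embedding of a finite connected graph $G$, rooted at a half-edge $a$, and let $M_G^\#$ be the map $(H,\sigma^{ -1},\alpha)$ rooted at $\sigma^{ -1}(a)$. For every spanning tree $T$ of $G$, an edge in $T$ (resp. not in $T$) is $(M_G,T)$-active if and only if it is maximal for the $(M_G^\#,T)$-ordering in its fundamental cocycle (resp. fundamental cycle).
   Context: A combinatorial map $(H,\sigma,\alpha)$: finite set $H$ of half-edges, permutation $\sigma$, fixed-point-free involution $\alpha$, with $\langle\sigma,\alpha\rangle$ transitive on $H$, rooted at a half-edge. Its underlying graph has a vertex per cycle of $\sigma$ and an edge $\{h,\alpha(h)\}$ per cycle of $\alpha$, incident when cycles intersect; an embedding of $G$ is a map whose underlying graph is $G$. For a rooted map with root $h_0$ and a spanning tree $T$, the motion function is $t(h)=\sigma(h)$ if the edge of $h$ is not in $T$ and $t(h)=\sigma(\alpha(h))$ if it is in $T$; it is a cyclic permutation of $H$ (a known fact), giving the order $h_0<t(h_0)<t^2(h_0)<\dots$ on half-edges, and on edges $\{h_1,h_1'\}<\{h_2,h_2'\}$ iff $\min(h_1,h_1')<\min(h_2,h_2')$; this is the $(M,T)$-ordering for the rooted map $M$. Fundamental cycle of $e\notin T$: the unique cycle in $T\cup\{e\}$; fundamental cocycle of $e\in T$: edges with one endpoint in each component of $T\setminus e$. An edge not in $T$ (resp. in $T$) is $(M_G,T)$-active if it is minimal for the $(M_G,T)$-ordering in its fundamental cycle (resp. cocycle). -}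

module Defs where

open import Data.Nat using (ℕ; zero; suc; _<_; _⊓_)
open import Data.Fin using (Fin; _≟_)
open import Data.Fin.Permutation using (Permutation′; _⟨$⟩ʳ_; _⟨$⟩ˡ_)
open import Data.Bool using (Bool; true; false; if_then_else_; _∧_; not)
open import Data.List using (List; []; _∷_; map)
open import Data.List.Relation.Unary.Any using (Any)
open import Data.List.Relation.Unary.AllPairs using (AllPairs)
open import Data.Product using (Σ; ∃; _×_)
open import Data.Sum using (_⊎_)
open import Relation.Nullary using (¬_)
open import Relation.Nullary.Decidable using (⌊_⌋)
open import Relation.Binary.PropositionalEquality using (_≡_; _≢_)

iter : {A : Set} → (A → A) → ℕ → A → A
iter f zero x = x
iter f (suc k) x = f (iter f k x)

-- With S = const true, s = σ, si = σ⁻¹,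
-- a = α this is the orbit relation of the group ⟨σ, α⟩.  With S a set of
-- edges, it is "the vertices of h and h' are connected in the spanning
-- subgraph with edge set S".
data Conn {n : ℕ} (s si a : Fin n → Fin n) (S : Fin n → Bool)
          : Fin n → Fin n → Set where
  here  : ∀ {x} → Conn s si a S x x
  viaσ  : ∀ {x y} → Conn s si a S (s x) y → Conn s si a S x y
  viaσ⁻ : ∀ {x y} → Conn s si a S (si x) y → Conn s si a S x y
  viaα  : ∀ {x y} → S x ≡ true → Conn s si a S (a x) y → Conn s si a S x y

record CombMap (n : ℕ) : Set where
  field
    σ          : Permutation′ n
    α          : Fin n → Fin n
    α-invol    : ∀ h → α (α h) ≡ h
    α-fpf      : ∀ h → α h ≢ h
    transitive : ∀ h h' → Conn (σ ⟨$⟩ʳ_) (σ ⟨$⟩ˡ_) α (λ _ → true) h h'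

module _ {n : ℕ} (M : CombMap n) where
  open CombMap M

  s⁺ s⁻ : Fin n → Fin n
  s⁺ h = σ ⟨$⟩ʳ h
  s⁻ h = σ ⟨$⟩ˡ h

  SameVertex : Fin n → Fin n → Set
  SameVertex h h' = ∃ λ k → iter s⁺ k h ≡ h'

  -- connectivity (of the vertices of h, h') in the spanning subgraph with
  -- edge set S (S a predicate on half-edges, meant to be α-closed)
  ConnIn : (Fin n → Bool) → Fin n → Fin n → Set
  ConnIn S = Conn s⁺ s⁻ α S

  remove : (Fin n → Bool) → Fin n → Fin n → Bool
  remove S e x = S x ∧ not ⌊ x ≟ e ⌋ ∧ not ⌊ x ≟ α e ⌋

  -- T (given as a set of half-edges closed under α) is a spanning tree of
  -- the underlying graph: a connected spanning subgraph that becomes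
  -- disconnected upon removal of any of its edges (i.e. it is acyclic).
  record IsSpanningTree (T : Fin n → Bool) : Set where
    field
      α-closed  : ∀ h → T (α h) ≡ T h
      connected : ∀ h h' → ConnIn T h h'
      acyclic   : ∀ e → T e ≡ true → ¬ ConnIn (remove T e) e (α e)

  -- A path in T from the vertex of u to the vertex of v, given as the list
  -- of half-edges h₁ … hₖ traversed (hᵢ leaves the current vertex, α hᵢ
  -- arrives at the next one).
  data TPath (T : Fin n → Bool) : Fin n → List (Fin n) → Fin n → Set where
    stop : ∀ {u v} → SameVertex u v → TPath T u [] v
    step : ∀ {u h hs v} → SameVertex u h → T h ≡ true →
           TPath T (α h) hs v → TPath T u (h ∷ hs) v

  SimpleTPath : (Fin n → Bool) → Fin n → List (Fin n) → Fin n → Set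
  SimpleTPath T u hs v =
    TPath T u hs v × AllPairs (λ x y → ¬ SameVertex x y) (u ∷ map α hs)

  EdgeOn : Fin n → List (Fin n) → Set
  EdgeOn f hs = Any (λ h → h ≡ f ⊎ α h ≡ f) hs

  InFundCycle : (Fin n → Bool) → Fin n → Fin n → Set
  InFundCycle T e f =
    (f ≡ e ⊎ f ≡ α e) ⊎
    (∃ λ hs → SimpleTPath T (α e) hs e × EdgeOn f hs)

  -- fundamental cocycle of e ∈ T: edges whose endpoints lie in different
  -- components of T ∖ e.
  InFundCocycle : (Fin n → Bool) → Fin n → Fin n → Set
  InFundCocycle T e f = ¬ ConnIn (remove T e) f (α f)

-- least k < N with p k ≡ true (N if there is none)
leastBelow : ℕ → (ℕ → Bool) → ℕ
leastBelow zero p = zero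
leastBelow (suc N) p = if p zero then zero else suc (leastBelow N (λ k → p (suc k)))

rank : {n : ℕ} → (Fin n → Fin n) → Fin n → Fin n → ℕ
rank {n} t r h = leastBelow n (λ k → ⌊ iter t k r ≟ h ⌋)

module _ {n : ℕ} (M : CombMap n) where
  open CombMap M

  motion : (Fin n → Bool) → Fin n → Fin n
  motion T h = if T h then σ ⟨$⟩ʳ (α h) else σ ⟨$⟩ʳ h

  motion# : (Fin n → Bool) → Fin n → Fin n
  motion# T h = if T h then σ ⟨$⟩ˡ (α h) else σ ⟨$⟩ˡ h

  -- key of the edge {h, α h} in the (M,T)-ordering for M rooted at a:
  -- edges compare by the smaller of their two half-edge positions
  edgeKey : Fin n → (Fin n → Bool) → Fin n → ℕ
  edgeKey a T h = rank (motion T) a h ⊓ rank (motion T) a (α h)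

  edgeKey# : Fin n → (Fin n → Bool) → Fin n → ℕ
  edgeKey# a T h =
    rank (motion# T) (σ ⟨$⟩ˡ a) h ⊓ rank (motion# T) (σ ⟨$⟩ˡ a) (α h)

  Active : Fin n → (Fin n → Bool) → Fin n → Set
  Active a T e =
    (T e ≡ true  → ∀ f → InFundCocycle M T e f → ¬ (edgeKey a T f < edgeKey a T e)) ×
    (T e ≡ false → ∀ f → InFundCycle M T e f   → ¬ (edgeKey a T f < edgeKey a T e))

  MaxInCocycle# : Fin n → (Fin n → Bool) → Fin n → Set
  MaxInCocycle# a T e =
    ∀ f → InFundCocycle M T e f → ¬ (edgeKey# a T e < edgeKey# a T f)

  MaxInCycle# : Fin n → (Fin n → Bool) → Fin n → Set
  MaxInCycle# a T e =
    ∀ f → InFundCycle M T e f → ¬ (edgeKey# a T e < edgeKey# a T f)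

module Submission where

-- Write β for α on tree half-edges and the identity elsewhere.  The motion
-- function of M is t = σ ∘ β, that of M# is σ⁻¹ ∘ β = β ∘ t⁻¹ ∘ β.  The proof
-- has three parts.
--  * Cycles.  t is a cyclic permutation (its orbit through the root is closed
--    under β, hence under σ, σ⁻¹ and α on T, hence everything).  Reading the
--    cycle of t backwards and conjugating by β shows that the (M#,T)-rank of x
--    is p - 1 - R (β x), where R is the (M,T)-rank and p the length of the
--    cycle; so the (M#,T)-key of an edge is p - 1 minus its LARGER (M,T)-rank.
--  * Cuts.  If e ∈ T, the t-cycle leaves the root's side of T ∖ e only at one
--    half-edge of e and comes back only at the other (Interval lemma).  Hence
--    every edge f of the fundamental cocycle of e straddles an interval of the
--    cycle, and f is below e by smaller rank iff it is below e by larger rank.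
--  * Cycles vs. cocycles.  An edge f ≠ e of the fundamental cycle of e ∉ T has
--    e in its fundamental cocycle, and tree and non-tree edges never share keys,
--    so the same comparison holds in the cycle case.
-- Minimality by smaller rank is activity, minimality by larger rank is
-- maximality for M#; the theorem follows.

open import Defs
open import Data.Nat as ℕ using (ℕ; zero; suc; _+_; _*_; _∸_; _≤_; _<_; z≤n; s≤s; _⊓_; _⊔_)
open import Data.Nat.Properties hiding (_≟_)
open import Data.Nat.DivMod using (_%_; _/_; m≡m%n+[m/n]*n; m%n<n)
open import Data.Fin using (Fin; toℕ; _≟_)
open import Data.Fin.Properties using (pigeonhole; toℕ<n)
open import Data.Fin.Permutation using (_⟨$⟩ʳ_; _⟨$⟩ˡ_; inverseˡ; inverseʳ)
open import Data.Bool using (Bool; true; false; if_then_else_)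
open import Data.List using (_∷_; map)
open import Data.List.Relation.Unary.All using (All; _∷_)
open import Data.List.Relation.Unary.Any using (here; there)
open import Data.List.Relation.Unary.AllPairs using (AllPairs; _∷_)
open import Data.Product using (∃; _×_; _,_; proj₁; proj₂)
open import Data.Sum using (_⊎_; inj₁; inj₂)
open import Data.Empty using (⊥; ⊥-elim)
open import Function using (_∘_)
open import Function.Bundles using (_⇔_; mk⇔; Equivalence)
open import Function.Properties.Equivalence using () renaming (trans to ⇔-trans)
open import Relation.Nullary using (¬_; yes; no; contradiction)
open import Relation.Nullary.Decidable using (⌊_⌋)
open import Relation.Binary.PropositionalEquality
open import Relation.Binary.Definitions using (tri<; tri≈; tri>)

open Equivalence using (to; from)

iter-suc : {A : Set} (f : A → A) (k : ℕ) (x : A) → iter f (suc k) x ≡ iter f k (f x)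
iter-suc f zero x = refl
iter-suc f (suc k) x = cong f (iter-suc f k x)

iter-add : {A : Set} (f : A → A) (m k : ℕ) (x : A) →
           iter f (m + k) x ≡ iter f m (iter f k x)
iter-add f zero k x = refl
iter-add f (suc m) k x = cong f (iter-add f m k x)

iter-inj : {A : Set} (f : A → A) → (∀ {x y} → f x ≡ f y → x ≡ y) →
           (k : ℕ) {x y : A} → iter f k x ≡ iter f k y → x ≡ y
iter-inj f f-inj zero eq = eq
iter-inj f f-inj (suc k) eq = iter-inj f f-inj k (f-inj eq)

iter-inv : {A : Set} (f g : A → A) → (∀ x → g (f x) ≡ x) →
           (m : ℕ) (x : A) → iter g m (iter f m x) ≡ x
iter-inv f g gf zero x = refl
iter-inv f g gf (suc m) x = begin
  iter g (suc m) (iter f (suc m) x) ≡⟨ iter-suc g m _ ⟩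
  iter g m (g (f (iter f m x)))     ≡⟨ cong (iter g m) (gf _) ⟩
  iter g m (iter f m x)             ≡⟨ iter-inv f g gf m x ⟩
  x                                 ∎
  where open ≡-Reasoning

iter-mul : {A : Set} (f : A → A) (p : ℕ) (x : A) → iter f p x ≡ x →
           (q : ℕ) → iter f (q * p) x ≡ x
iter-mul f p x fix zero = refl
iter-mul f p x fix (suc q) =
  trans (iter-add f p (q * p) x) (trans (cong (iter f p) (iter-mul f p x fix q)) fix)

iter-return : {A : Set} (f : A → A) → (∀ {x y} → f x ≡ f y → x ≡ y) →
              ∀ {i j x} → i < j → iter f i x ≡ iter f j x →
              iter f (suc (j ∸ suc i)) x ≡ x
iter-return f f-inj {i} {j} {x} i<j eq = sym (iter-inj f f-inj i (begin
  iter f i x                  ≡⟨ eq ⟩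
  iter f j x                  ≡⟨ cong (λ k → iter f k x) (sym j≡i+d) ⟩
  iter f (i + suc d) x        ≡⟨ iter-add f i (suc d) x ⟩
  iter f i (iter f (suc d) x) ∎))
  where
  open ≡-Reasoning
  d = j ∸ suc i
  j≡i+d : i + suc d ≡ j
  j≡i+d = trans (+-suc i d) (m+[n∸m]≡n i<j)

periodic : {n : ℕ} (f : Fin n → Fin n) → (∀ {x y} → f x ≡ f y → x ≡ y) →
           (x : Fin n) → ∃ λ m → suc m ≤ n × iter f (suc m) x ≡ x
periodic {n} f f-inj x with pigeonhole (n<1+n n) (λ i → iter f (toℕ i) x)
... | i , j , i<j , eq =
  toℕ j ∸ suc (toℕ i) ,
  ≤-trans (∸-monoʳ-< (s≤s z≤n) i<j) (ℕ.s≤s⁻¹ (toℕ<n j)) ,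
  iter-return f f-inj i<j eq

≟-true : ∀ {n} {x y : Fin n} → x ≡ y → ⌊ x ≟ y ⌋ ≡ true
≟-true {x = x} {y} eq with x ≟ y
... | yes _ = refl
... | no x≢y = contradiction eq x≢y

≟-false : ∀ {n} {x y : Fin n} → x ≢ y → ⌊ x ≟ y ⌋ ≡ false
≟-false {x = x} {y} x≢y with x ≟ y
... | yes eq = contradiction eq x≢y
... | no _ = refl

≟-sound : ∀ {n} {x y : Fin n} → ⌊ x ≟ y ⌋ ≡ true → x ≡ y
≟-sound {x = x} {y} hit with x ≟ y
... | yes eq = eq
≟-sound () | no _

leastBelow-found : ∀ N (p : ℕ → Bool) k → k < N → p k ≡ true →
                   leastBelow N p ≤ k × p (leastBelow N p) ≡ true
leastBelow-found (suc N) p zero _ pk rewrite pk = z≤n , pk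
leastBelow-found (suc N) p (suc k) k<N pk with p zero in p0
... | true = z≤n , p0
... | false =
  let found = leastBelow-found N (λ j → p (suc j)) k (ℕ.s≤s⁻¹ k<N) pk
  in s≤s (proj₁ found) , proj₂ found

leastBelow-below : ∀ N (p : ℕ → Bool) j → j < leastBelow N p → p j ≡ false
leastBelow-below (suc N) p j lt with p zero in p0
leastBelow-below (suc N) p zero    () | true
leastBelow-below (suc N) p (suc j) () | true
leastBelow-below (suc N) p zero    lt | false = p0
leastBelow-below (suc N) p (suc j) lt | false =
  leastBelow-below N (λ k → p (suc k)) j (ℕ.s≤s⁻¹ lt)

leastBelow-spec : ∀ N (p : ℕ → Bool) k → k < N → p k ≡ true →
                  (∀ j → j < k → p j ≡ false) → leastBelow N p ≡ k
leastBelow-spec N p k k<N pk earlier with leastBelow-found N p k k<N pk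
... | le , hit with m≤n⇒m<n∨m≡n le
...   | inj₁ lt = contradiction (trans (sym hit) (earlier _ lt)) λ ()
...   | inj₂ eq = eq

leastBelow-cong : ∀ N {p q : ℕ → Bool} → (∀ k → p k ≡ q k) →
                  leastBelow N p ≡ leastBelow N q
leastBelow-cong zero eq = refl
leastBelow-cong (suc N) {p} {q} eq rewrite eq zero =
  cong (λ m → if q zero then zero else suc m) (leastBelow-cong N (λ k → eq (suc k)))

rank-conj : {n : ℕ} (f g β : Fin n → Fin n) → (∀ x → β (β x) ≡ x) →
            (∀ x → g x ≡ β (f (β x))) → ∀ r x → rank g (β r) x ≡ rank f r (β x)
rank-conj {n} f g β β-invol g≡ r x =
  leastBelow-cong n (λ k → trans (cong (λ z → ⌊ z ≟ x ⌋) (iter-conj k)) (test _))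
  where
  iter-conj : ∀ k → iter g k (β r) ≡ β (iter f k r)
  iter-conj zero = refl
  iter-conj (suc k) = trans (cong g (iter-conj k)) (trans (g≡ _) (cong (β ∘ f) (β-invol _)))
  test : ∀ y → ⌊ β y ≟ x ⌋ ≡ ⌊ y ≟ β x ⌋
  test y with β y ≟ x | y ≟ β x
  ... | yes _ | yes _ = refl
  ... | no _ | no _ = refl
  ... | yes eq | no ne = contradiction (trans (sym (β-invol y)) (cong β eq)) ne
  ... | no ne | yes eq = contradiction (trans (cong β eq) (β-invol x)) ne

order-both : ∀ {a b c d : ℕ} → a < b → c < d → (a < b) ⇔ (c < d)
order-both a<b c<d = mk⇔ (λ _ → c<d) (λ _ → a<b)

order-neither : ∀ {a b c d : ℕ} → ¬ a < b → ¬ c < d → (a < b) ⇔ (c < d)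
order-neither a≮b c≮d = mk⇔ (λ lt → contradiction lt a≮b) (λ lt → contradiction lt c≮d)

order-cong : ∀ {a a' b b' c c' d d' : ℕ} → a ≡ a' → b ≡ b' → c ≡ c' → d ≡ d' →
             (a < b) ⇔ (c < d) → (a' < b') ⇔ (c' < d')
order-cong refl refl refl refl same = same

order-refl : ∀ {a b c d : ℕ} → a ≡ b → c ≡ d → (a < b) ⇔ (c < d)
order-refl refl refl = order-neither (<-irrefl refl) (<-irrefl refl)

order-flip : ∀ {a b c d : ℕ} → a ≢ b → c ≢ d → (a < b) ⇔ (c < d) → (b < a) ⇔ (d < c)
order-flip a≢b c≢d same = mk⇔
  (λ b<a → ≤∧≢⇒< (≮⇒≥ (λ c<d → <-asym b<a (from same c<d))) (c≢d ∘ sym))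
  (λ d<c → ≤∧≢⇒< (≮⇒≥ (λ a<b → <-asym d<c (to same a<b))) (a≢b ∘ sym))

∸-suc-reverse : ∀ {p x y} → x < p → (p ∸ suc x < p ∸ suc y) ⇔ (y < x)
∸-suc-reverse {p} x<p = mk⇔
  (λ lt → ≰⇒> (λ x≤y → <⇒≱ lt (∸-monoʳ-≤ p (s≤s x≤y))))
  (λ y<x → ∸-monoʳ-< (s≤s y<x) x<p)

straddle-order : ∀ {i j y z} → i < j → y ≤ i ⊎ j < y → i < z → z ≤ j →
                 (y ≡ i) ⇔ (z ≡ j) → (y ⊓ z < i ⊓ j) ⇔ (y ⊔ z < i ⊔ j)
straddle-order {i} {j} {y} {z} i<j y-out i<z z≤j ends =
  order-cong refl (sym (m≤n⇒m⊓n≡m (<⇒≤ i<j))) refl (sym (m≤n⇒m⊔n≡n (<⇒≤ i<j)))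
    (compare y-out)
  where
  compare : y ≤ i ⊎ j < y → (y ⊓ z < i) ⇔ (y ⊔ z < j)
  compare (inj₂ j<y) =
    order-neither (≤⇒≯ (⊓-glb (<⇒≤ (<-trans i<j j<y)) (<⇒≤ i<z)))
                  (≤⇒≯ (≤-trans (<⇒≤ j<y) (m≤m⊔n y z)))
  compare (inj₁ y≤i) with m≤n⇒m<n∨m≡n y≤i
  ... | inj₂ y≡i =
    order-neither (≤⇒≯ (⊓-glb (≤-reflexive (sym y≡i)) (<⇒≤ i<z)))
                  (≤⇒≯ (≤-trans (≤-reflexive (sym (to ends y≡i))) (m≤n⊔m y z)))
  ... | inj₁ y<i =
    order-both (≤-<-trans (m⊓n≤m y z) y<i)
               (⊔-lub (<-trans y<i (<-≤-trans i<z z≤j))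
                      (≤∧≢⇒< z≤j (λ z≡j → <-irrefl (from ends z≡j) y<i)))

module _ {n : ℕ} {s si a : Fin n → Fin n} where

  conn-trans : ∀ {S x y z} → Conn s si a S x y → Conn s si a S y z → Conn s si a S x z
  conn-trans here q = q
  conn-trans (viaσ p) q = viaσ (conn-trans p q)
  conn-trans (viaσ⁻ p) q = viaσ⁻ (conn-trans p q)
  conn-trans (viaα e p) q = viaα e (conn-trans p q)

  conn-iter : ∀ {S} k {x y} → iter s k x ≡ y → Conn s si a S x y
  conn-iter zero refl = here
  conn-iter (suc k) {x} eq = viaσ (conn-iter k (trans (sym (iter-suc s k x)) eq))

  conn-mono : ∀ {S S' x y} → (∀ z → S z ≡ true → S' z ≡ true) →
              Conn s si a S x y → Conn s si a S' x y
  conn-mono S⊆S' here = here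
  conn-mono S⊆S' (viaσ p) = viaσ (conn-mono S⊆S' p)
  conn-mono S⊆S' (viaσ⁻ p) = viaσ⁻ (conn-mono S⊆S' p)
  conn-mono S⊆S' (viaα e p) = viaα (S⊆S' _ e) (conn-mono S⊆S' p)

  conn-sym : ∀ {S} → (∀ x → si (s x) ≡ x) → (∀ x → s (si x) ≡ x) → (∀ x → a (a x) ≡ x) →
             (∀ x → S x ≡ true → S (a x) ≡ true) →
             ∀ {x y} → Conn s si a S x y → Conn s si a S y x
  conn-sym sis ssi aa Sa here = here
  conn-sym {S} sis ssi aa Sa {x} (viaσ p) =
    conn-trans (conn-sym sis ssi aa Sa p) (viaσ⁻ (subst (λ z → Conn s si a S z x) (sym (sis x)) here))
  conn-sym {S} sis ssi aa Sa {x} (viaσ⁻ p) =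
    conn-trans (conn-sym sis ssi aa Sa p) (viaσ (subst (λ z → Conn s si a S z x) (sym (ssi x)) here))
  conn-sym {S} sis ssi aa Sa {x} (viaα e p) =
    conn-trans (conn-sym sis ssi aa Sa p) (viaα (Sa x e) (subst (λ z → Conn s si a S z x) (sym (aa x)) here))

module Orbit {n : ℕ} (t u : Fin n → Fin n) (u-t : ∀ x → u (t x) ≡ x) where

  t-inj : ∀ {x y} → t x ≡ t y → x ≡ y
  t-inj {x} {y} eq = trans (sym (u-t x)) (trans (cong u eq) (u-t y))

  InOrbit : Fin n → Fin n → Set
  InOrbit a x = ∃ λ k → iter t k a ≡ x

  orbit-iter : ∀ {a x} → InOrbit a x → ∀ j → InOrbit a (iter t j x)
  orbit-iter {a} (k , e) j = j + k , trans (iter-add t j k a) (cong (iter t j) e)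

  -- orbits are closed under the inverse, since x = t^(m+1) x
  orbit-u : ∀ {a x} → InOrbit a x → InOrbit a (u x)
  orbit-u {a} {x} r with periodic t t-inj x
  ... | m , _ , back = subst (InOrbit a) (trans (sym (u-t _)) (cong u back)) (orbit-iter r m)

  -- When the orbit of a is everything, t is a single cycle of length p, and
  -- R = rank t a is the position on it.
  module Cyclic (a : Fin n) (reach : ∀ x → InOrbit a x) where

    pm : ℕ
    pm = leastBelow n (λ k → ⌊ iter t (suc k) a ≟ a ⌋)

    p : ℕ
    p = suc pm

    period : p ≤ n × iter t p a ≡ a
    period with periodic t t-inj a
    ... | m , m<n , back with leastBelow-found n _ m m<n (≟-true back)
    ...   | pm≤m , hit = ≤-trans (s≤s pm≤m) m<n , ≟-sound hit

    p≤n : p ≤ n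
    p≤n = proj₁ period

    no-early-return : ∀ k → k < pm → iter t (suc k) a ≢ a
    no-early-return k k<pm back =
      contradiction (trans (sym (≟-true back)) (leastBelow-below n _ k k<pm)) λ ()

    iterates-distinct : ∀ {i j} → i < j → j < p → iter t i a ≢ iter t j a
    iterates-distinct {i} {j} i<j j<p eq =
      no-early-return (j ∸ suc i) (<-≤-trans (∸-monoʳ-< (s≤s z≤n) i<j) (ℕ.s≤s⁻¹ j<p))
                      (iter-return t t-inj i<j eq)

    iterates-injective : ∀ {i j} → i < p → j < p → iter t i a ≡ iter t j a → i ≡ j
    iterates-injective {i} {j} i<p j<p eq with <-cmp i j
    ... | tri< i<j _ _ = ⊥-elim (iterates-distinct i<j j<p eq)
    ... | tri≈ _ i≡j _ = i≡j
    ... | tri> _ _ j<i = ⊥-elim (iterates-distinct j<i i<p (sym eq))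

    below-period : ∀ x → ∃ λ r → r < p × iter t r a ≡ x
    below-period x with reach x
    ... | k , e = k % p , m%n<n k p , (begin
      iter t (k % p) a                      ≡⟨ cong (iter t (k % p)) (sym (iter-mul t p a (proj₂ period) (k / p))) ⟩
      iter t (k % p) (iter t (k / p * p) a) ≡⟨ sym (iter-add t (k % p) (k / p * p) a) ⟩
      iter t (k % p + k / p * p) a          ≡⟨ cong (λ m → iter t m a) (sym (m≡m%n+[m/n]*n k p)) ⟩
      iter t k a                            ≡⟨ e ⟩
      x                                     ∎)
      where open ≡-Reasoning

    R : Fin n → ℕ
    R = rank t a

    R-position : ∀ x → R x < p × iter t (R x) a ≡ x
    R-position x with below-period x
    ... | r , r<p , e with leastBelow-found n (λ k → ⌊ iter t k a ≟ x ⌋) r (<-≤-trans r<p p≤n) (≟-true e)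
    ...   | R≤r , hit = ≤-<-trans R≤r r<p , ≟-sound hit

    R<p : ∀ x → R x < p
    R<p x = proj₁ (R-position x)

    R-iter : ∀ x → iter t (R x) a ≡ x
    R-iter x = proj₂ (R-position x)

    R-spec : ∀ {k x} → k < p → iter t k a ≡ x → R x ≡ k
    R-spec {k} {x} k<p e = iterates-injective (R<p x) k<p (trans (R-iter x) (sym e))

    R-inj : ∀ {x y} → R x ≡ R y → x ≡ y
    R-inj {x} {y} e = trans (sym (R-iter x)) (trans (cong (λ k → iter t k a) e) (R-iter y))

    backwards : ∀ k r → suc k + r ≡ p → iter u k (u a) ≡ iter t r a
    backwards k r k+r = begin
      iter u k (u a)                               ≡⟨ sym (iter-suc u k a) ⟩
      iter u (suc k) a                             ≡⟨ cong (iter u (suc k)) (sym (proj₂ period)) ⟩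
      iter u (suc k) (iter t p a)                  ≡⟨ cong (λ m → iter u (suc k) (iter t m a)) (sym k+r) ⟩
      iter u (suc k) (iter t (suc k + r) a)        ≡⟨ cong (iter u (suc k)) (iter-add t (suc k) r a) ⟩
      iter u (suc k) (iter t (suc k) (iter t r a)) ≡⟨ iter-inv t u u-t (suc k) _ ⟩
      iter t r a                                   ∎
      where open ≡-Reasoning

    rank-backwards : ∀ x → rank u (u a) x ≡ p ∸ suc (R x)
    rank-backwards x =
      leastBelow-spec n _ k (<-≤-trans k<p p≤n) (≟-true (trans (backwards k r k+r) (R-iter x))) earlier
      where
      r = R x
      k = p ∸ suc r
      k+r : suc k + r ≡ p
      k+r = trans (sym (+-suc k r)) (m∸n+n≡m (R<p x))
      k<p : k < p
      k<p = subst (suc k ≤_) k+r (m≤m+n (suc k) r)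
      earlier : ∀ j → j < k → ⌊ iter u j (u a) ≟ x ⌋ ≡ false
      earlier j j<k = ≟-false λ hit →
        <-irrefl (R-spec q<p (trans (sym (backwards j q j+q)) hit)) r<q
        where
        q = p ∸ suc j
        j<p = <-trans j<k k<p
        j+q : suc j + q ≡ p
        j+q = m+[n∸m]≡n j<p
        q<p : q < p
        q<p = ∸-monoʳ-< (s≤s z≤n) j<p
        r<q : r < q
        r<q = +-cancelˡ-< (suc j) r q
                (subst (suc j + r <_) (trans k+r (sym j+q)) (+-monoˡ-< r (s≤s j<k)))

    -- Suppose the half-edges are split into disjoint classes A ∋ a and B, and
    -- t keeps each class except at c ∈ A (where it moves to B) and c' ∈ B
    -- (where it moves back).  Then B is exactly the stretch (R c, R c'] of
    -- the cycle.
    module Interval (A B : Fin n → Set) (disjoint : ∀ {x} → A x → B x → ⊥)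
                    (c c' : Fin n) (c≢c' : c ≢ c') (a∈A : A a) (c'∈B : B c')
                    (stayA : ∀ {x} → A x → x ≢ c → A (t x))
                    (stayB : ∀ {x} → B x → x ≢ c' → B (t x))
                    (leaveA : B (t c)) (leaveB : A (t c')) where

      i j : ℕ
      i = R c
      j = R c'

      X : ℕ → Fin n
      X k = iter t k a

      X≢ : ∀ {k x} → k < p → k ≢ R x → X k ≢ x
      X≢ k<p k≢ e = k≢ (sym (R-spec k<p e))

      initial : ∀ k → k ≤ i → A (X k)
      initial zero _ = a∈A
      initial (suc k) k<i =
        stayA (initial k (<⇒≤ k<i)) (X≢ (<-trans k<i (R<p c)) (<⇒≢ k<i))

      i<j : i < j
      i<j with <-cmp i j
      ... | tri< lt _ _ = lt
      ... | tri≈ _ eq _ = ⊥-elim (c≢c' (R-inj eq))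
      ... | tri> _ _ gt = ⊥-elim (disjoint (subst A (R-iter c') (initial j (<⇒≤ gt))) c'∈B)

      middle : ∀ k → i < k → k ≤ j → B (X k)
      middle (suc k) i<sk k<j with k ℕ.≟ i
      ... | yes refl = subst (B ∘ t) (sym (R-iter c)) leaveA
      ... | no k≢i = stayB (middle k i<k (<⇒≤ k<j)) (X≢ (<-trans k<j (R<p c')) (<⇒≢ k<j))
        where i<k = ≤∧≢⇒< (ℕ.s≤s⁻¹ i<sk) (k≢i ∘ sym)

      final : ∀ k → j < k → k < p → A (X k)
      final (suc k) j<sk sk<p with k ℕ.≟ j
      ... | yes refl = subst (A ∘ t) (sym (R-iter c')) leaveB
      ... | no k≢j = stayA (final k j<k k<p) (X≢ k<p (λ k≡i → <⇒≢ (<-trans i<j j<k) (sym k≡i)))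
        where
        j<k = ≤∧≢⇒< (ℕ.s≤s⁻¹ j<sk) (k≢j ∘ sym)
        k<p = <-trans (n<1+n k) sk<p

      position-A : ∀ {x} → A x → R x ≤ i ⊎ j < R x
      position-A {x} ax with R x ℕ.≤? i | j ℕ.<? R x
      ... | yes le | _ = inj₁ le
      ... | no _ | yes lt = inj₂ lt
      ... | no nle | no nlt =
        ⊥-elim (disjoint ax (subst B (R-iter x) (middle (R x) (≰⇒> nle) (≮⇒≥ nlt))))

      position-B : ∀ {x} → B x → i < R x × R x ≤ j
      position-B {x} bx with R x ℕ.≤? i | j ℕ.<? R x
      ... | yes le | _ = ⊥-elim (disjoint (subst A (R-iter x) (initial (R x) le)) bx)
      ... | no _ | yes lt = ⊥-elim (disjoint (subst A (R-iter x) (final (R x) lt (R<p x))) bx)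
      ... | no nle | no nlt = ≰⇒> nle , ≮⇒≥ nlt

      straddle : ∀ {y z} → A y → B z → (y ≡ c) ⇔ (z ≡ c') →
                 (R y ⊓ R z < i ⊓ j) ⇔ (R y ⊔ R z < i ⊔ j)
      straddle ay bz ends =
        straddle-order i<j (position-A ay) (proj₁ (position-B bz)) (proj₂ (position-B bz))
          (mk⇔ (cong R ∘ to ends ∘ R-inj) (cong R ∘ from ends ∘ R-inj))

active-tree : ∀ {n} (M : CombMap n) a T e → T e ≡ true →
              Active M a T e ⇔
              (∀ f → InFundCocycle M T e f → ¬ edgeKey M a T f < edgeKey M a T e)
active-tree M a T e te =
  mk⇔ (λ act → proj₁ act te) (λ minimal → (λ _ → minimal) , λ tf → contradiction (trans (sym te) tf) λ ())

active-cotree : ∀ {n} (M : CombMap n) a T e → T e ≡ false →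
                Active M a T e ⇔
                (∀ f → InFundCycle M T e f → ¬ edgeKey M a T f < edgeKey M a T e)
active-cotree M a T e tf =
  mk⇔ (λ act → proj₂ act tf) (λ minimal → (λ te → contradiction (trans (sym te) tf) λ ()) , λ _ → minimal)

module SpanningTree {n : ℕ} (M : CombMap n) (T : Fin n → Bool) (tree : IsSpanningTree M T) where
  open CombMap M
  open IsSpanningTree tree

  sp sm : Fin n → Fin n
  sp = s⁺ M
  sm = s⁻ M

  sm-sp : ∀ x → sm (sp x) ≡ x
  sm-sp x = inverseˡ σ

  sp-sm : ∀ x → sp (sm x) ≡ x
  sp-sm x = inverseʳ σ

  sp-inj : ∀ {x y} → sp x ≡ sp y → x ≡ y
  sp-inj {x} {y} e = trans (sym (sm-sp x)) (trans (cong sm e) (sm-sp y))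

  α-inj : ∀ {x y} → α x ≡ α y → x ≡ y
  α-inj {x} {y} e = trans (sym (α-invol x)) (trans (cong α e) (α-invol y))

  CI : (Fin n → Bool) → Fin n → Fin n → Set
  CI = ConnIn M

  β : Fin n → Fin n
  β x = if T x then α x else x

  β-tree : ∀ {x} → T x ≡ true → β x ≡ α x
  β-tree {x} e = cong (λ b → if b then α x else x) e

  β-cotree : ∀ {x} → T x ≡ false → β x ≡ x
  β-cotree {x} e = cong (λ b → if b then α x else x) e

  β-invol : ∀ x → β (β x) ≡ x
  β-invol x with T x in eq
  ... | true = trans (β-tree (trans (α-closed x) eq)) (α-invol x)
  ... | false = β-cotree eq

  t : Fin n → Fin n
  t = motion M T

  t≡ : ∀ x → t x ≡ sp (β x)
  t≡ x with T x
  ... | true = refl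
  ... | false = refl

  t# : Fin n → Fin n
  t# = motion# M T

  t#≡ : ∀ x → t# x ≡ sm (β x)
  t#≡ x with T x
  ... | true = refl
  ... | false = refl

  u : Fin n → Fin n
  u x = β (sm x)

  u-t : ∀ x → u (t x) ≡ x
  u-t x = trans (cong (β ∘ sm) (t≡ x)) (trans (cong β (sm-sp (β x))) (β-invol x))

  t-tree : ∀ {x} → T x ≡ true → t x ≡ sp (α x)
  t-tree {x} e = trans (t≡ x) (cong sp (β-tree e))

  -- t# is t⁻¹ conjugated by β
  t#-conj : ∀ x → t# x ≡ β (u (β x))
  t#-conj x = trans (t#≡ x) (sym (β-invol _))

  open Orbit t u u-t

  rem : Fin n → Fin n → Bool
  rem = remove M T

  rem-intro : ∀ {e x} → T x ≡ true → x ≢ e → x ≢ α e → rem e x ≡ true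
  rem-intro {e} {x} tx x≢e x≢αe with T x | x ≟ e | x ≟ α e
  ... | true | no _ | no _ = refl
  ... | true | yes eq | _ = contradiction eq x≢e
  ... | true | no _ | yes eq = contradiction eq x≢αe
  rem-intro () _ _ | false | _ | _

  rem-elim : ∀ {e x} → rem e x ≡ true → T x ≡ true × x ≢ e × x ≢ α e
  rem-elim {e} {x} r with T x | x ≟ e | x ≟ α e
  ... | true | no x≢e | no x≢αe = refl , x≢e , x≢αe
  rem-elim () | true | yes _ | _
  rem-elim () | true | no _ | yes _
  rem-elim () | false | _ | _

  rem-α : ∀ e x → rem e x ≡ true → rem e (α x) ≡ true
  rem-α e x r with rem-elim {e} {x} r
  ... | tx , x≢e , x≢αe =
    rem-intro (trans (α-closed x) tx) (λ eq → x≢αe (trans (sym (α-invol x)) (cong α eq))) (x≢e ∘ α-inj)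

  rem-flip : ∀ e x → rem e x ≡ true → rem (α e) x ≡ true
  rem-flip e x r with rem-elim {e} {x} r
  ... | tx , x≢e , x≢αe = rem-intro tx x≢αe (λ eq → x≢e (trans eq (α-invol e)))

  rem-unflip : ∀ e x → rem (α e) x ≡ true → rem e x ≡ true
  rem-unflip e x r with rem-elim {α e} {x} r
  ... | tx , x≢αe , x≢ααe = rem-intro tx (λ eq → x≢ααe (trans eq (sym (α-invol e)))) x≢αe

  csym : ∀ e {x y} → CI (rem e) x y → CI (rem e) y x
  csym e = conn-sym sm-sp sp-sm α-invol (rem-α e)

  tstep : ∀ e x → x ≢ e → x ≢ α e → CI (rem e) x (t x)
  tstep e x x≢e x≢αe with T x in eq
  ... | true = viaα (rem-intro eq x≢e x≢αe) (viaσ here)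
  ... | false = viaσ here

  split : ∀ e x → CI (rem e) e x ⊎ CI (rem e) (α e) x
  split e x = go (connected e x) (inj₁ here)
    where
    Side : Fin n → Set
    Side y = CI (rem e) e y ⊎ CI (rem e) (α e) y
    extend : ∀ {y z} → CI (rem e) y z → Side y → Side z
    extend q (inj₁ p) = inj₁ (conn-trans p q)
    extend q (inj₂ p) = inj₂ (conn-trans p q)
    go : ∀ {y z} → CI T y z → Side y → Side z
    go here s = s
    go (viaσ p) s = go p (extend (viaσ here) s)
    go (viaσ⁻ p) s = go p (extend (viaσ⁻ here) s)
    go {y} (viaα ty p) s with y ≟ e | y ≟ α e
    ... | yes refl | _ = go p (inj₂ here)
    ... | no _ | yes refl = go p (inj₁ (subst (CI (rem e) e) (sym (α-invol e)) here))
    ... | no y≢e | no y≢αe = go p (extend (viaα (rem-intro ty y≢e y≢αe) here) s)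

  sides-disjoint : ∀ e → T e ≡ true → ∀ {x} → CI (rem e) e x → CI (rem e) (α e) x → ⊥
  sides-disjoint e te ex αex = acyclic e te (conn-trans ex (csym e αex))

  -- From a tree half-edge h, t enters the side of α h in T ∖ h and stays
  -- there until it meets α h (it cannot meet h first, h being on the other
  -- side).
  walk : ∀ h → T h ≡ true → ∀ j →
         (∃ λ k → iter t k h ≡ α h) ⊎ CI (rem h) (α h) (iter t (suc j) h)
  walk h th zero = inj₂ (subst (CI (rem h) (α h)) (sym (t-tree th)) (viaσ here))
  walk h th (suc j) with walk h th j
  ... | inj₁ found = inj₁ found
  ... | inj₂ c with iter t (suc j) h ≟ h | iter t (suc j) h ≟ α h
  ...   | yes X≡h | _ = ⊥-elim (acyclic h th (csym h (subst (CI (rem h) (α h)) X≡h c)))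
  ...   | no _ | yes X≡αh = inj₁ (suc j , X≡αh)
  ...   | no X≢h | no X≢αh = inj₂ (conn-trans c (tstep h _ X≢h X≢αh))

  returns-opposite : ∀ h → T h ≡ true → InOrbit h (α h)
  returns-opposite h th with periodic t t-inj h
  ... | m , _ , back with walk h th m
  ...   | inj₁ found = found
  ...   | inj₂ c = ⊥-elim (acyclic h th (csym h (subst (CI (rem h) (α h)) back c)))

  -- orbits are closed under β, hence under σ, σ⁻¹ and tree edges
  orbit-β : ∀ {a x} → InOrbit a x → InOrbit a (β x)
  orbit-β {a} {x} r with T x in eq
  ... | true = let (k , e) = returns-opposite x eq in subst (InOrbit a) e (orbit-iter r k)
  ... | false = r

  orbit-conn : ∀ {a x y} → CI T x y → InOrbit a x → InOrbit a y
  orbit-conn here r = r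
  orbit-conn {a} {x} (viaσ p) r =
    orbit-conn p (subst (InOrbit a) (trans (t≡ (β x)) (cong sp (β-invol x))) (orbit-iter (orbit-β r) 1))
  orbit-conn {a} {x} (viaσ⁻ p) r =
    orbit-conn p (subst (InOrbit a) (β-invol (sm x)) (orbit-β (orbit-u r)))
  orbit-conn {a} {x} (viaα e p) r = orbit-conn p (subst (InOrbit a) (β-tree e) (orbit-β r))

  reach : ∀ a x → InOrbit a x
  reach a x = orbit-conn (connected a x) (0 , refl)

  SV : Fin n → Fin n → Set
  SV = SameVertex M

  sv-trans : ∀ {x y z} → SV x y → SV y z → SV x z
  sv-trans {x} (k , e1) (l , e2) = l + k , trans (iter-add sp l k x) (trans (cong (iter sp l) e1) e2)

  sv-sym : ∀ {x y} → SV x y → SV y x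
  sv-sym {x} {y} (k , e) with periodic sp sp-inj x
  ... | m , _ , back = k * m , (begin
    iter sp (k * m) y                ≡⟨ cong (iter sp (k * m)) (sym e) ⟩
    iter sp (k * m) (iter sp k x)    ≡⟨ sym (iter-add sp (k * m) k x) ⟩
    iter sp (k * m + k) x            ≡⟨ cong (λ z → iter sp z x) (trans (+-comm (k * m) k) (sym (*-suc k m))) ⟩
    iter sp (k * suc m) x            ≡⟨ iter-mul sp (suc m) x back k ⟩
    x                                ∎)
    where open ≡-Reasoning

  sv-conn : ∀ {S x y} → SV x y → CI S x y
  sv-conn (k , e) = conn-iter k e

  avoiding-path : ∀ {f w hs v} → TPath M T w hs v → ¬ EdgeOn M f hs → CI (rem f) w v
  avoiding-path (stop sv) _ = sv-conn sv
  avoiding-path {f} (step sv th rest) off =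
    conn-trans (sv-conn sv)
      (viaα (rem-intro th (λ e → off (here (inj₁ e))) (λ e → off (here (inj₂ (trans (cong α e) (α-invol f))))))
            (avoiding-path rest (off ∘ there)))

  off-path : ∀ {u f w hs v} → TPath M T w hs v → EdgeOn M f hs →
             All (λ y → ¬ SV u y) (w ∷ map α hs) → ¬ SV u f × ¬ SV u (α f)
  off-path (step sv th rest) (here (inj₁ refl)) (u≁w ∷ u≁αh ∷ _) =
    (λ uf → u≁w (sv-trans uf (sv-sym sv))) , u≁αh
  off-path {u} (step {h = h} sv th rest) (here (inj₂ refl)) (u≁w ∷ u≁αh ∷ _) =
    u≁αh , (λ uαf → u≁w (sv-trans (subst (SV u) (α-invol h) uαf) (sv-sym sv)))
  off-path (step sv th rest) (there on) (_ ∷ avoided) = off-path rest on avoided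

  path-in-T : ∀ {f w hs v} → TPath M T w hs v → EdgeOn M f hs → T f ≡ true
  path-in-T (step sv th rest) (here (inj₁ refl)) = th
  path-in-T (step {h = h} sv th rest) (here (inj₂ refl)) = trans (α-closed h) th
  path-in-T (step sv th rest) (there on) = path-in-T rest on

  path-separates : ∀ {f w hs v} → TPath M T w hs v → AllPairs (λ x y → ¬ SV x y) (w ∷ map α hs) →
                   EdgeOn M f hs → ¬ CI (rem f) w v
  path-separates {f} (step {h = h} sv th rest) (avoided ∷ simple) on c with h ≟ f | h ≟ α f
  ... | yes refl | _ = acyclic h th
      (conn-trans (csym h (sv-conn sv)) (conn-trans c (csym h (avoiding-path rest (λ on' → proj₁ (off-path rest on' avoided) sv)))))
  ... | no _ | yes refl = acyclic f (trans (sym (α-closed f)) th)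
      (csym f (subst (CI (rem f) (α f)) (α-invol f)
        (conn-trans (csym f (sv-conn sv)) (conn-trans c (csym f (avoiding-path rest (λ on' → proj₂ (off-path rest on' avoided) sv)))))))
  ... | no h≢f | no h≢αf with on
  ...   | here (inj₁ e) = h≢f e
  ...   | here (inj₂ e) = h≢αf (trans (sym (α-invol h)) (cong α e))
  ...   | there on' =
    path-separates rest simple on' (conn-trans (csym f (conn-trans (sv-conn sv) (viaα (rem-intro th h≢f h≢αf) here))) c)

  module Rooted (a : Fin n) where
    open Cyclic a (reach a)

    mn Mx : Fin n → ℕ
    mn h = R h ⊓ R (α h)
    Mx h = R h ⊔ R (α h)

    Mx<p : ∀ h → Mx h < p
    Mx<p h = ⊔-lub (R<p h) (R<p (α h))

    mn-α : ∀ h → mn (α h) ≡ mn h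
    mn-α h = trans (cong (λ z → R (α h) ⊓ R z) (α-invol h)) (⊓-comm (R (α h)) (R h))

    Mx-α : ∀ h → Mx (α h) ≡ Mx h
    Mx-α h = trans (cong (λ z → R (α h) ⊔ R z) (α-invol h)) (⊔-comm (R (α h)) (R h))

    rank# : ∀ x → rank t# (sm a) x ≡ p ∸ suc (R (β x))
    rank# x = begin
      rank t# (sm a) x      ≡⟨ cong (λ r → rank t# r x) (sym (β-invol (sm a))) ⟩
      rank t# (β (u a)) x   ≡⟨ rank-conj u t# β β-invol t#-conj (u a) x ⟩
      rank u (u a) (β x)    ≡⟨ rank-backwards (β x) ⟩
      p ∸ suc (R (β x))     ∎
      where open ≡-Reasoning

    β-Mx : ∀ h → R (β h) ⊔ R (β (α h)) ≡ Mx h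
    β-Mx h with T h in eq
    ... | true = trans (cong (λ z → R (α h) ⊔ R z) (trans (β-tree (trans (α-closed h) eq)) (α-invol h)))
                       (⊔-comm (R (α h)) (R h))
    ... | false = cong (λ z → R h ⊔ R z) (β-cotree (trans (α-closed h) eq))

    key# : ∀ h → edgeKey# M a T h ≡ p ∸ suc (Mx h)
    key# h = begin
      edgeKey# M a T h                              ≡⟨ cong₂ _⊓_ (rank# h) (rank# (α h)) ⟩
      (p ∸ suc (R (β h))) ⊓ (p ∸ suc (R (β (α h)))) ≡⟨ sym (∸-distribˡ-⊔-⊓ p (suc (R (β h))) (suc (R (β (α h))))) ⟩
      p ∸ suc (R (β h) ⊔ R (β (α h)))               ≡⟨ cong (λ m → p ∸ suc m) (β-Mx h) ⟩
      p ∸ suc (Mx h)                                ∎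
      where open ≡-Reasoning

    key#-order : ∀ e f → (edgeKey# M a T e < edgeKey# M a T f) ⇔ (Mx f < Mx e)
    key#-order e f = order-cong (sym (key# e)) (sym (key# f)) refl refl (∸-suc-reverse (Mx<p e))

    Coherent : Fin n → Fin n → Set
    Coherent f e = (mn f < mn e) ⇔ (Mx f < Mx e)

    min⇔max# : ∀ {e} (P : Fin n → Set) → (∀ f → P f → Coherent f e) →
               (∀ f → P f → ¬ mn f < mn e) ⇔ (∀ f → P f → ¬ edgeKey# M a T e < edgeKey# M a T f)
    min⇔max# P coh = mk⇔
      (λ minimal f pf lt → minimal f pf (from (coh f pf) (to (key#-order _ f) lt)))
      (λ maximal f pf lt → maximal f pf (from (key#-order _ f) (to (coh f pf) lt)))

    -- Remove a tree half-edge c whose side in T ∖ c contains the root.  The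
    -- cycle t leaves that side exactly at c and re-enters exactly at α c.
    module Cut (c : Fin n) (tc : T c ≡ true) (root-near : CI (rem c) c a) where
      Near Far : Fin n → Set
      Near = CI (rem c) c
      Far = CI (rem c) (α c)

      apart : ∀ {x} → Near x → Far x → ⊥
      apart = sides-disjoint c tc

      stay-near : ∀ {x} → Near x → x ≢ c → Near (t x)
      stay-near {x} nx x≢c = conn-trans nx (tstep c x x≢c (λ e → apart nx (subst Far (sym e) here)))

      stay-far : ∀ {x} → Far x → x ≢ α c → Far (t x)
      stay-far {x} fx x≢αc = conn-trans fx (tstep c x (λ e → apart (subst Near (sym e) here) fx) x≢αc)

      leave-near : Far (t c)
      leave-near = subst Far (sym (t-tree tc)) (viaσ here)

      leave-far : Near (t (α c))
      leave-far = subst Near (sym (trans (t-tree (trans (α-closed c) tc)) (cong sp (α-invol c)))) (viaσ here)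

      open Interval Near Far apart c (α c) (α-fpf c ∘ sym) root-near here stay-near stay-far leave-near leave-far

      opposite-ends : ∀ y → (y ≡ c) ⇔ (α y ≡ α c)
      opposite-ends y = mk⇔ (cong α) α-inj

      coherent : ∀ f → ¬ CI (rem c) f (α f) → Coherent f c
      coherent f cut with split c f | split c (α f)
      ... | inj₁ nf | inj₁ nαf = ⊥-elim (cut (conn-trans (csym c nf) nαf))
      ... | inj₂ ff | inj₂ fαf = ⊥-elim (cut (conn-trans (csym c ff) fαf))
      ... | inj₁ nf | inj₂ fαf = straddle nf fαf (opposite-ends f)
      ... | inj₂ ff | inj₁ nαf = order-cong (mn-α f) refl (Mx-α f) refl
              (straddle nαf (subst Far (sym (α-invol f)) ff) (opposite-ends (α f)))

    cocycle-coherent : ∀ e → T e ≡ true → ∀ f → InFundCocycle M T e f → Coherent f e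
    cocycle-coherent e te f cut with split e a
    ... | inj₁ root-near = Cut.coherent e te root-near f cut
    ... | inj₂ root-far = order-cong refl (mn-α e) refl (Mx-α e)
            (Cut.coherent (α e) (trans (α-closed e) te) (conn-mono (rem-flip e) root-far) f
                          (cut ∘ conn-mono (rem-unflip e)))

    selected-rank : (_∙_ : ℕ → ℕ → ℕ) → (∀ m k → (m ∙ k ≡ m) ⊎ (m ∙ k ≡ k)) →
                    ∀ h → ∃ λ x → T x ≡ T h × R h ∙ R (α h) ≡ R x
    selected-rank _∙_ sel h with sel (R h) (R (α h))
    ... | inj₁ eq = h , refl , eq
    ... | inj₂ eq = α h , α-closed h , eq

    keys-differ : (_∙_ : ℕ → ℕ → ℕ) → (∀ m k → (m ∙ k ≡ m) ⊎ (m ∙ k ≡ k)) →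
                  ∀ {e f} → T e ≢ T f → R e ∙ R (α e) ≢ R f ∙ R (α f)
    keys-differ _∙_ sel {e} {f} Te≢Tf eq
      with selected-rank _∙_ sel e | selected-rank _∙_ sel f
    ... | x , Tx≡Te , ex | y , Ty≡Tf , ey =
      Te≢Tf (trans (sym Tx≡Te) (trans (cong T (R-inj (trans (sym ex) (trans eq ey)))) Ty≡Tf))

    cycle-coherent : ∀ e → T e ≡ false → ∀ f → InFundCycle M T e f → Coherent f e
    cycle-coherent e te f (inj₁ (inj₁ refl)) = order-refl refl refl
    cycle-coherent e te f (inj₁ (inj₂ refl)) = order-refl (mn-α e) (Mx-α e)
    cycle-coherent e te f (inj₂ (hs , (path , simple) , on)) =
      order-flip (keys-differ _⊓_ ⊓-sel Te≢Tf) (keys-differ _⊔_ ⊔-sel Te≢Tf)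
        (cocycle-coherent f tf e (λ c → path-separates path simple on (csym f c)))
      where
      tf = path-in-T path on
      Te≢Tf : T e ≢ T f
      Te≢Tf eq = contradiction (trans (sym te) (trans eq tf)) λ ()


lemma7p4 : {n : ℕ} (M : CombMap n) (a : Fin n) (T : Fin n → Bool) →
           IsSpanningTree M T → (e : Fin n) →
           (T e ≡ true → (Active M a T e ⇔ MaxInCocycle# M a T e)) ×
           (T e ≡ false → (Active M a T e ⇔ MaxInCycle# M a T e))
lemma7p4 M a T tree e =
  (λ te → ⇔-trans (active-tree M a T e te) (min⇔max# (InFundCocycle M T e) (cocycle-coherent e te))) ,
  (λ tf → ⇔-trans (active-cotree M a T e tf) (min⇔max# (InFundCycle M T e) (cycle-coherent e tf)))
  where
  open SpanningTree M T tree
  open Rooted a
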